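{- For every graph $G$, $\check{\mu}(G)=\min\{l\in\mathbb{N}_0 : \overline{K_l}\ast G\text{ is Hamiltonian}\}$, where $\overline{K_l}$ is the edgeless graph on $l$ vertices.
   Context: All graphs are finite and simple with nonempty vertex set. By convention $K_1$ and $K_2$ are regarded as Hamiltonian (in addition to graphs with a Hamiltonian cycle). $G\ast H$ is the join ($G\sqcup H$ plus all edges between $V(G)$ and $V(H)$); $K_0$ is the empty graph so $K_0\ast G=G$. $\check{\mu}(G)=\min\{l\in\mathbb{N}_0: K_l\ast G\text{ is Hamiltonian}\}$. -}

module Defs where

open import Data.Nat using (ℕ; zero; suc; _+_; _≤_)
open import Data.Fin using (Fin; zero; suc; inject₁; fromℕ; splitAt; _≟_)
open import Data.Fin.Permutation using (Permutation′; _⟨$⟩ʳ_)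
open import Data.Bool using (Bool; true; false; not)
open import Data.Sum using (_⊎_; inj₁; inj₂)
open import Data.Product using (Σ; _×_)
open import Data.Empty using (⊥)
open import Data.Unit using (⊤)
open import Relation.Nullary.Decidable using (⌊_⌋)
open import Relation.Binary.PropositionalEquality using (_≡_)

record Graph : Set where
  constructor graph
  field
    n   : ℕ
    adj : Fin n → Fin n → Bool
open Graph public

record IsSimpleGraph (G : Graph) : Set where
  field
    nonempty : 1 ≤ n G
    symmetric : ∀ i j → adj G i j ≡ adj G j i
    loopless  : ∀ i → adj G i i ≡ false

K : ℕ → Graph
K l = graph l (λ i j → not ⌊ i ≟ j ⌋)

coK : ℕ → Graph
coK l = graph l (λ _ _ → false)

joinAdj : ∀ {m k} → (Fin m → Fin m → Bool) → (Fin k → Fin k → Bool)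
        → Fin (m + k) → Fin (m + k) → Bool
joinAdj {m} a b x y with splitAt m x | splitAt m y
... | inj₁ i | inj₁ j = a i j
... | inj₂ i | inj₂ j = b i j
... | inj₁ _ | inj₂ _ = true
... | inj₂ _ | inj₁ _ = true

_∗_ : Graph → Graph → Graph
G ∗ H = graph (n G + n H) (joinAdj (adj G) (adj H))

HamCycle : (k : ℕ) → (Fin (suc k) → Fin (suc k) → Bool) → Set
HamCycle k a = Σ (Permutation′ (suc k)) λ σ →
  (∀ (i : Fin k) → a (σ ⟨$⟩ʳ inject₁ i) (σ ⟨$⟩ʳ suc i) ≡ true)
  × (a (σ ⟨$⟩ʳ fromℕ k) (σ ⟨$⟩ʳ zero) ≡ true)

-- Hamiltonian, with the convention that K_1 and K_2 are Hamiltonian.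
HamiltonianAdj : (m : ℕ) → (Fin m → Fin m → Bool) → Set
HamiltonianAdj zero a = ⊥
HamiltonianAdj (suc zero) a = ⊤
HamiltonianAdj (suc (suc zero)) a = a zero (suc zero) ≡ true
HamiltonianAdj (suc (suc (suc k))) a = HamCycle (suc (suc k)) a

Hamiltonian : Graph → Set
Hamiltonian G = HamiltonianAdj (n G) (adj G)

IsMinimum : (ℕ → Set) → ℕ → Set
IsMinimum P m = P m × (∀ l → P l → m ≤ l)

-- Since coK l ∗ G is a spanning subgraph of K l ∗ G, it suffices to show that if K l ∗ G is
-- Hamiltonian then so is coK j ∗ G for some j ≤ l. Every vertex of K (1 + l) is universal in
-- K (1 + l) ∗ G. If a Hamiltonian cycle of it uses an edge between two such vertices, delete
-- one end of that edge: the other end is adjacent to everything, so the cycle closes up in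
-- K l ∗ G, and we conclude by induction on l. Otherwise the cycle already lies in
-- coK (1 + l) ∗ G.
module Submission where

open import Defs
open import Data.Nat using (ℕ; zero; suc; _+_; _≤_; z≤n)
open import Data.Nat.Properties using (≤-refl; ≤-trans; ≤-antisym; m≤n⇒m≤1+n)
open import Data.Fin using (Fin; zero; suc; inject₁; fromℕ; punchIn; splitAt; _↑ˡ_; _≟_)
open import Data.Fin.Properties using (any?; 0≢1+n; punchIn-injective; splitAt-↑ˡ; splitAt⁻¹-↑ˡ)
open import Data.Fin.Induction using (>-weakInduction)
open import Data.Fin.Permutation
  using (Permutation′; _⟨$⟩ʳ_; permutation; _∘ₚ_; remove; punchIn-permute)
open import Data.Bool using (Bool; true)
open import Data.Product using (_×_; _,_; ∃; ∃-syntax)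
open import Data.Sum using (_⊎_; inj₁; inj₂; map₁)
open import Data.Unit using (tt)
open import Function.Bundles using (_⇔_; mk⇔; Injection)
open import Function.Properties.Inverse using (↔⇒↣)
open import Level using (0ℓ)
open import Relation.Nullary using (¬_; yes; no; _×-dec_; contradiction)
open import Relation.Unary using (Pred; Decidable)
open import Relation.Binary.PropositionalEquality

Adj : ℕ → Set
Adj n = Fin n → Fin n → Bool

IsSymmetric : ∀ {n} → Adj n → Set
IsSymmetric a = ∀ x y → a x y ≡ a y x

Universal : ∀ {n} → Adj n → Fin n → Set
Universal a u = ∀ x → x ≢ u → a u x ≡ true

IsVertexDeletion : ∀ {n} → Adj (suc n) → Fin (suc n) → Adj n → Set
IsVertexDeletion a v a′ = ∀ i j → a′ i j ≡ a (punchIn v i) (punchIn v j)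

_⊆_ : ∀ {n} → Adj n → Adj n → Set
a ⊆ b = ∀ x y → a x y ≡ true → b x y ≡ true

HamiltonianAdj-mono : ∀ n {a b : Adj n} → a ⊆ b → HamiltonianAdj n a → HamiltonianAdj n b
HamiltonianAdj-mono (suc zero)          a⊆b h                 = tt
HamiltonianAdj-mono (suc (suc zero))    a⊆b h                 = a⊆b _ _ h
HamiltonianAdj-mono (suc (suc (suc k))) a⊆b (σ , path , wrap) =
  σ , (λ i → a⊆b _ _ (path i)) , a⊆b _ _ wrap

prev : ∀ {k} → Fin (suc k) → Fin (suc k)
prev {k} zero = fromℕ k
prev (suc i) = inject₁ i

next : ∀ {k} → Fin (suc k) → Fin (suc k)
next {zero}  zero    = zero
next {suc k} zero    = suc zero
next {suc k} (suc i) with next i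
... | zero  = zero
... | suc j = suc (suc j)

next-inject₁ : ∀ {k} (i : Fin k) → next (inject₁ i) ≡ suc i
next-inject₁ {suc k} zero    = refl
next-inject₁ {suc k} (suc i) rewrite next-inject₁ i = refl

next-fromℕ : ∀ k → next (fromℕ k) ≡ zero
next-fromℕ zero    = refl
next-fromℕ (suc k) rewrite next-fromℕ k = refl

next-prev : ∀ {k} (i : Fin (suc k)) → next (prev i) ≡ i
next-prev {k} zero = next-fromℕ k
next-prev (suc i)  = next-inject₁ i

prev-next : ∀ {k} (i : Fin (suc k)) → prev (next i) ≡ i
prev-next {zero}  zero    = refl
prev-next {suc k} zero    = refl
prev-next {suc k} (suc i) with next i | prev-next i
... | zero  | eq = cong suc eq
... | suc j | eq = cong suc eq

rotation : ∀ {k} → Permutation′ (suc k)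
rotation = permutation prev next prev-next next-prev

permutation-injective : ∀ {n} (σ : Permutation′ n) {x y} → σ ⟨$⟩ʳ x ≡ σ ⟨$⟩ʳ y → x ≡ y
permutation-injective σ = Injection.injective (↔⇒↣ σ)

record IsCycle {k} (a : Adj (suc k)) (σ : Permutation′ (suc k)) : Set where
  constructor isCycle
  field adjacent : ∀ i → a (σ ⟨$⟩ʳ prev i) (σ ⟨$⟩ʳ i) ≡ true
open IsCycle

HamCycle⇒IsCycle : ∀ {k} (a : Adj (suc k)) → HamCycle k a → ∃ (IsCycle a)
HamCycle⇒IsCycle a (σ , path , wrap) = σ , isCycle λ { zero → wrap ; (suc i) → path i }

IsCycle⇒HamCycle : ∀ {k} {a : Adj (suc k)} → ∃ (IsCycle a) → HamCycle k a
IsCycle⇒HamCycle (σ , cyc) = σ , (λ i → adjacent cyc (suc i)) , adjacent cyc zero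

IsCycle⇒HamiltonianAdj : ∀ {k} {a : Adj (suc k)} → IsSymmetric a → ∃ (IsCycle a) →
                         HamiltonianAdj (suc k) a
IsCycle⇒HamiltonianAdj {zero}        sym-a _   = tt
IsCycle⇒HamiltonianAdj {suc (suc k)} sym-a cyc = IsCycle⇒HamCycle cyc
IsCycle⇒HamiltonianAdj {suc zero} {a} sym-a (σ , cyc)
  with σ ⟨$⟩ʳ zero in σ0 | σ ⟨$⟩ʳ suc zero in σ1
... | zero     | suc zero = trans (sym-a zero (suc zero))
                              (subst₂ (λ x y → a x y ≡ true) σ1 σ0 (adjacent cyc zero))
... | suc zero | zero     = subst₂ (λ x y → a x y ≡ true) σ1 σ0 (adjacent cyc zero)
... | zero     | zero     with () ← permutation-injective σ (trans σ0 (sym σ1))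
... | suc zero | suc zero with () ← permutation-injective σ (trans σ0 (sym σ1))

IsCycle-rotate : ∀ {k} {a : Adj (suc k)} {σ} → IsCycle a σ → IsCycle a (rotation ∘ₚ σ)
IsCycle-rotate cyc = isCycle λ i → adjacent cyc (prev i)

EdgeWithin : ∀ {k} → Pred (Fin (suc k)) 0ℓ → Permutation′ (suc k) → Fin (suc k) → Set
EdgeWithin U σ p = U (σ ⟨$⟩ʳ prev p) × U (σ ⟨$⟩ʳ p)

IsCycle-rotateEdgeToLast : ∀ {k} {a : Adj (suc k)} (U : Pred (Fin (suc k)) 0ℓ) p {σ} →
  IsCycle a σ → EdgeWithin U σ p → ∃[ τ ] IsCycle a τ × EdgeWithin U τ (fromℕ k)
IsCycle-rotateEdgeToLast {k} {a} U p {σ} = >-weakInduction Movable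
  (λ σ cyc e → σ , cyc , e)
  (λ i movable σ cyc e → movable (rotation ∘ₚ σ) (IsCycle-rotate cyc) e)
  p σ
  where
  Movable : Pred (Fin (suc k)) 0ℓ
  Movable p = ∀ σ → IsCycle a σ → EdgeWithin U σ p → ∃[ τ ] IsCycle a τ × EdgeWithin U τ (fromℕ k)

punchIn-fromℕ : ∀ {n} (j : Fin n) → punchIn (fromℕ n) j ≡ inject₁ j
punchIn-fromℕ zero    = refl
punchIn-fromℕ (suc j) = cong suc (punchIn-fromℕ j)

-- Deleting the last vertex τ(L) joins its neighbours τ(L-1) and τ(0); they are adjacent
-- because τ(L-1) is universal.
IsCycle-removeLast : ∀ {k} {a : Adj (suc (suc (suc k)))} {a′ : Adj (suc (suc k))} {τ} →
  let L = fromℕ (suc (suc k)) in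
  IsVertexDeletion a (τ ⟨$⟩ʳ L) a′ → Universal a (τ ⟨$⟩ʳ prev L) → IsCycle a τ →
  IsCycle a′ (remove L τ)
IsCycle-removeLast {k} {a} {a′} {τ} deletion universal cyc = isCycle λ j → begin
  a′ (ρ ⟨$⟩ʳ prev j) (ρ ⟨$⟩ʳ j)                                         ≡⟨ deletion _ _ ⟩
  a (punchIn (τ ⟨$⟩ʳ L) (ρ ⟨$⟩ʳ prev j)) (punchIn (τ ⟨$⟩ʳ L) (ρ ⟨$⟩ʳ j))  ≡⟨ cong₂ a (kept (prev j)) (kept j) ⟨
  a (τ ⟨$⟩ʳ inject₁ (prev j)) (τ ⟨$⟩ʳ inject₁ j)                         ≡⟨ edge j ⟩
  true                                                                    ∎
  where
  open ≡-Reasoning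
  L = fromℕ (suc (suc k))
  ρ = remove L τ

  kept : ∀ j → τ ⟨$⟩ʳ inject₁ j ≡ punchIn (τ ⟨$⟩ʳ L) (ρ ⟨$⟩ʳ j)
  kept j = trans (cong (τ ⟨$⟩ʳ_) (sym (punchIn-fromℕ j))) (punchIn-permute τ L j)

  edge : ∀ j → a (τ ⟨$⟩ʳ inject₁ (prev j)) (τ ⟨$⟩ʳ inject₁ j) ≡ true
  edge zero    = universal (τ ⟨$⟩ʳ zero) (λ eq → 0≢1+n (permutation-injective τ eq))
  edge (suc i) = adjacent cyc (inject₁ (suc i))

HamiltonianAdj-universalDeletion⊎avoiding : ∀ {N} {a c : Adj (suc N)} {a′ : Adj N}
  (U : Pred (Fin (suc N)) 0ℓ) → Decidable U →
  (∀ {v} → U v → IsVertexDeletion a v a′) →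
  (∀ {u} → U u → Universal a u) →
  (∀ x y → ¬ (U x × U y) → a x y ≡ true → c x y ≡ true) →
  IsSymmetric a′ →
  HamiltonianAdj (suc N) a → HamiltonianAdj N a′ ⊎ HamiltonianAdj (suc N) c
HamiltonianAdj-universalDeletion⊎avoiding {zero}     _ _ _ _ _ _ _ = inj₂ tt
HamiltonianAdj-universalDeletion⊎avoiding {suc zero} _ _ _ _ _ _ _ = inj₁ tt
HamiltonianAdj-universalDeletion⊎avoiding {suc (suc k)} {a} {c}
  U U? deletion universal avoiding sym-a′ h
  with σ , cyc ← HamCycle⇒IsCycle a h
  with any? (λ p → U? (σ ⟨$⟩ʳ prev p) ×-dec U? (σ ⟨$⟩ʳ p))
... | yes (p , edge) =
  let τ , cycτ , (U-kept , U-deleted) = IsCycle-rotateEdgeToLast U p cyc edge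
  in inj₁ (IsCycle⇒HamiltonianAdj sym-a′ (remove _ τ ,
             IsCycle-removeLast (deletion U-deleted) (universal U-kept) cycτ))
... | no ¬edge = inj₂ (IsCycle⇒HamCycle (σ , isCycle {a = c} λ i →
                   avoiding _ _ (λ e → ¬edge (i , e)) (adjacent cyc i)))

IsLeft : ∀ l {m} → Pred (Fin (l + m)) 0ℓ
IsLeft l {m} x = ∃[ i ] i ↑ˡ m ≡ x

isLeft? : ∀ l {m} → Decidable (IsLeft l {m})
isLeft? l {m} x with splitAt l x in eq
... | inj₁ i = yes (i , splitAt⁻¹-↑ˡ eq)
... | inj₂ j = no λ (i , i↑ˡm≡x) →
  inj₁≢inj₂ (trans (sym (splitAt-↑ˡ l i m)) (trans (cong (splitAt l) i↑ˡm≡x) eq))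
  where
  inj₁≢inj₂ : ∀ {i : Fin l} {j : Fin m} → inj₁ i ≢ inj₂ j
  inj₁≢inj₂ ()

splitAt-punchIn-↑ˡ : ∀ {l} m (v : Fin (suc l)) (x : Fin (l + m)) →
  splitAt (suc l) (punchIn (v ↑ˡ m) x) ≡ map₁ (punchIn v) (splitAt l x)
splitAt-punchIn-↑ˡ         m zero    x       = refl
splitAt-punchIn-↑ˡ {suc l} m (suc v) zero    = refl
splitAt-punchIn-↑ˡ {suc l} m (suc v) (suc x) rewrite splitAt-punchIn-↑ˡ m v x with splitAt l x
... | inj₁ _ = refl
... | inj₂ _ = refl

joinAdj-vertexDeletion : ∀ {l m} {a : Adj (suc l)} {a′ : Adj l} (b : Adj m) v →
  IsVertexDeletion a v a′ → IsVertexDeletion (joinAdj a b) (v ↑ˡ m) (joinAdj a′ b)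
joinAdj-vertexDeletion {l} {m} b v deletion x y
  rewrite splitAt-punchIn-↑ˡ m v x | splitAt-punchIn-↑ˡ m v y
  with splitAt l x | splitAt l y
... | inj₁ i | inj₁ j = deletion i j
... | inj₁ _ | inj₂ _ = refl
... | inj₂ _ | inj₁ _ = refl
... | inj₂ _ | inj₂ _ = refl

joinAdj-universal : ∀ {l m} {a : Adj l} (b : Adj m) u →
  Universal a u → Universal (joinAdj a b) (u ↑ˡ m)
joinAdj-universal {l} {m} b u universal x x≢u rewrite splitAt-↑ˡ l u m with splitAt l x in eq
... | inj₁ i = universal i λ i≡u → x≢u (trans (sym (splitAt⁻¹-↑ˡ eq)) (cong (_↑ˡ m) i≡u))
... | inj₂ _ = refl

joinAdj-symmetric : ∀ {l m} {a : Adj l} {b : Adj m} →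
  IsSymmetric a → IsSymmetric b → IsSymmetric (joinAdj a b)
joinAdj-symmetric {l} sym-a sym-b x y with splitAt l x | splitAt l y
... | inj₁ i | inj₁ j = sym-a i j
... | inj₁ _ | inj₂ _ = refl
... | inj₂ _ | inj₁ _ = refl
... | inj₂ i | inj₂ j = sym-b i j

joinAdj-monoˡ : ∀ {l m} {a a′ : Adj l} (b : Adj m) → a ⊆ a′ → joinAdj a b ⊆ joinAdj a′ b
joinAdj-monoˡ {l} b a⊆a′ x y with splitAt l x | splitAt l y
... | inj₁ i | inj₁ j = a⊆a′ i j
... | inj₁ _ | inj₂ _ = λ h → h
... | inj₂ _ | inj₁ _ = λ h → h
... | inj₂ _ | inj₂ _ = λ h → h

joinAdj-outsideLeft : ∀ {l m} (a a′ : Adj l) (b : Adj m) x y →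
  ¬ (IsLeft l x × IsLeft l y) → joinAdj a b x y ≡ joinAdj a′ b x y
joinAdj-outsideLeft {l} a a′ b x y notBoth with splitAt l x in ex | splitAt l y in ey
... | inj₁ i | inj₁ j = contradiction ((i , splitAt⁻¹-↑ˡ ex) , (j , splitAt⁻¹-↑ˡ ey)) notBoth
... | inj₁ _ | inj₂ _ = refl
... | inj₂ _ | inj₁ _ = refl
... | inj₂ _ | inj₂ _ = refl

K-universal : ∀ l (u : Fin l) → Universal (adj (K l)) u
K-universal l u x x≢u with u ≟ x
... | yes u≡x = contradiction (sym u≡x) x≢u
... | no _    = refl

K-vertexDeletion : ∀ l (v : Fin (suc l)) → IsVertexDeletion (adj (K (suc l))) v (adj (K l))
K-vertexDeletion l v i j with i ≟ j | punchIn v i ≟ punchIn v j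
... | yes _    | yes _ = refl
... | no _     | no _  = refl
... | yes refl | no ¬p = contradiction refl ¬p
... | no i≢j   | yes p = contradiction (punchIn-injective v i j p) i≢j

K-symmetric : ∀ l → IsSymmetric (adj (K l))
K-symmetric l i j with i ≟ j | j ≟ i
... | yes _    | yes _   = refl
... | no _     | no _    = refl
... | yes refl | no j≢i  = contradiction refl j≢i
... | no i≢j   | yes refl = contradiction refl i≢j

coK⊆K : ∀ l → adj (coK l) ⊆ adj (K l)
coK⊆K l x y ()

Hamiltonian-K-suc∗⇒K∗⊎coK∗ : ∀ l (G : Graph) → IsSymmetric (adj G) →
  Hamiltonian (K (suc l) ∗ G) → Hamiltonian (K l ∗ G) ⊎ Hamiltonian (coK (suc l) ∗ G)
Hamiltonian-K-suc∗⇒K∗⊎coK∗ l G sym-G =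
  HamiltonianAdj-universalDeletion⊎avoiding (IsLeft (suc l)) (isLeft? (suc l))
    (λ { (v , refl) → joinAdj-vertexDeletion (adj G) v (K-vertexDeletion l v) })
    (λ { (u , refl) → joinAdj-universal (adj G) u (K-universal (suc l) u) })
    (λ x y notBoth → subst (_≡ true) (joinAdj-outsideLeft _ _ (adj G) x y notBoth))
    (joinAdj-symmetric (K-symmetric l) sym-G)

Hamiltonian-coK∗⇒K∗ : ∀ l (G : Graph) → Hamiltonian (coK l ∗ G) → Hamiltonian (K l ∗ G)
Hamiltonian-coK∗⇒K∗ l G = HamiltonianAdj-mono (l + n G) (joinAdj-monoˡ (adj G) (coK⊆K l))

Hamiltonian-K∗⇒coK∗ : ∀ l (G : Graph) → IsSymmetric (adj G) →
  Hamiltonian (K l ∗ G) → ∃[ j ] j ≤ l × Hamiltonian (coK j ∗ G)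
Hamiltonian-K∗⇒coK∗ zero    G sym-G h = zero , z≤n , h
Hamiltonian-K∗⇒coK∗ (suc l) G sym-G h with Hamiltonian-K-suc∗⇒K∗⊎coK∗ l G sym-G h
... | inj₂ h′ = suc l , ≤-refl , h′
... | inj₁ h′ with j , j≤l , h″ ← Hamiltonian-K∗⇒coK∗ l G sym-G h′ = j , m≤n⇒m≤1+n j≤l , h″

IsMinimum-coinitial : ∀ {P Q : ℕ → Set} → (∀ l → P l → Q l) →
  (∀ l → Q l → ∃[ j ] j ≤ l × P j) → ∀ m → IsMinimum Q m ⇔ IsMinimum P m
IsMinimum-coinitial {P} {Q} P⇒Q below m = mk⇔ toP toQ
  where
  toP : IsMinimum Q m → IsMinimum P m
  toP (Qm , minimal) with j , j≤m , Pj ← below m Qm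
    with refl ← ≤-antisym j≤m (minimal j (P⇒Q j Pj)) = Pj , λ l Pl → minimal l (P⇒Q l Pl)

  toQ : IsMinimum P m → IsMinimum Q m
  toQ (Pm , minimal) = P⇒Q m Pm , λ l Ql →
    let j , j≤l , Pj = below l Ql in ≤-trans (minimal j Pj) j≤l

lemma2p2 : (G : Graph) → IsSimpleGraph G → (m : ℕ) →
    IsMinimum (λ l → Hamiltonian (K l ∗ G)) m ⇔ IsMinimum (λ l → Hamiltonian (coK l ∗ G)) m
lemma2p2 G simple = IsMinimum-coinitial
  (λ l → Hamiltonian-coK∗⇒K∗ l G)
  (λ l → Hamiltonian-K∗⇒coK∗ l G (IsSimpleGraph.symmetric simple))
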